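{- Let $r\ge2$. Let $(A_n)_{n\ge0}$ be the sequence with $A_0=1$ satisfying, for all $n\ge1$ (with $A_j=0$ for $j<0$), $$(1-q^n)A_n=\sum_{m=1}^r\Big(d^{m-1}e_{m-1}(u_1,\dots,u_{r-1})+d^me_m(u_1,\dots,u_{r-1})+\sum_{i=1}^r\sum_{k=0}^{\min(i-1,m-1)}c_{k,i}b_{m-k,i}q^{i(n-m)}\Big)(-1)^{m+1}A_{n-m},$$ and let $(A'_n)_{n\ge0}$ be the sequence with $A'_0=1$ satisfying, for all $n\ge1$ (with $A'_j=0$ for $j<0$), $$(1-q^n)A'_n=\sum_{m=1}^r\Big(\sum_{\nu=0}^{r-1}\sum_{\mu=0}^{\min(m-1,\nu)}f_{m,\mu}e_{m,\nu-\mu}q^{\nu(n-m)}+u_r\sum_{\nu=1}^{r}\sum_{\mu=0}^{\min(m-1,\nu-1)}f_{m,\mu}e_{m,\nu-\mu-1}q^{\nu(n-m)}\Big)(-1)^{m+1}A'_{n-m}.$$ Then $A_n=A'_n$ for every $n\ge0$.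
   Context: $c_{k,i}:=d^ku_r^kq^{k(k+1)/2}{i-1\brack k}_q$; $b_{m,i}:=\big(d^{m-1}e_{i+m-1}(u_1,\dots,u_r)+d^me_{i+m}(u_1,\dots,u_r)\big){i+m-1\brack m-1}_q$; $e_{m,i}:=\big(d^{m-1}e_{i+m-1}(u_1,\dots,u_{r-1})+d^me_{i+m}(u_1,\dots,u_{r-1})\big){i+m-1\brack m-1}_q$; $f_{m,k}:=u_r^kq^{k(k+1)/2}{m-1\brack k}_q$. Here ${m\brack s}_q=\prod_{t=0}^{s-1}\frac{1-q^{m-t}}{1-q^{t+1}}$ for $0\le s\le m$ and $0$ otherwise, and $e_n(u_1,\dots,u_s)$ (single index) is the $n$-th elementary symmetric polynomial in $u_1,\dots,u_s$, with $e_0=1$ and $e_n=0$ for $n<0$ or $n>s$. $u_1,\dots,u_r,d,q$ are parameters (so $1-q^n$ is invertible and the sequences are uniquely determined). -}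

module Defs where

open import Level using (Level)
open import Algebra.Bundles using (CommutativeRing)
open import Data.Nat as ℕ using (ℕ; zero; suc; _∸_; _≤ᵇ_; _⊓_)
open import Data.Nat.DivMod using (_/_)
open import Data.Bool using (if_then_else_)

module WithRing {c ℓ : Level} (R : CommutativeRing c ℓ) where
  open CommutativeRing R

  pow : Carrier → ℕ → Carrier
  pow x zero    = 1#
  pow x (suc n) = x * pow x n

  -- Σ_{k=a}^{b} f k  (empty, i.e. 0, when b < a)
  sumFrom : ℕ → ℕ → (ℕ → Carrier) → Carrier
  sumFrom a zero      f = 0#
  sumFrom a (suc len) f = f a + sumFrom (suc a) len f

  Σ[_⋯_] : ℕ → ℕ → (ℕ → Carrier) → Carrier
  Σ[ a ⋯ b ] f = sumFrom a (suc b ∸ a) f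

  -- e_n(u_1,…,u_s), elementary symmetric polynomial (u is 1-based)
  esym : (ℕ → Carrier) → ℕ → ℕ → Carrier
  esym u zero    s       = 1#
  esym u (suc n) zero    = 0#
  esym u (suc n) (suc s) = esym u (suc n) s + u (suc s) * esym u n s

  qbin : Carrier → ℕ → ℕ → Carrier
  qbin q zero    zero    = 1#
  qbin q zero    (suc s) = 0#
  qbin q (suc m) zero    = 1#
  qbin q (suc m) (suc s) = qbin q m s + pow q (suc s) * qbin q m (suc s)

  tri : ℕ → ℕ
  tri k = (k ℕ.* suc k) / 2

  sign : ℕ → Carrier
  sign n = pow (- 1#) n

  prev : (ℕ → Carrier) → ℕ → ℕ → Carrier
  prev A n m = if m ≤ᵇ n then A (n ∸ m) else 0#

  module Params (r : ℕ) (u : ℕ → Carrier) (d q : Carrier) where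

    c' : ℕ → ℕ → Carrier
    c' k i = pow d k * pow (u r) k * pow q (tri k) * qbin q (i ∸ 1) k

    b' : ℕ → ℕ → Carrier
    b' m i = (pow d (m ∸ 1) * esym u (i ℕ.+ m ∸ 1) r + pow d m * esym u (i ℕ.+ m) r)
             * qbin q (i ℕ.+ m ∸ 1) (m ∸ 1)

    e' : ℕ → ℕ → Carrier
    e' m i = (pow d (m ∸ 1) * esym u (i ℕ.+ m ∸ 1) (r ∸ 1) + pow d m * esym u (i ℕ.+ m) (r ∸ 1))
             * qbin q (i ℕ.+ m ∸ 1) (m ∸ 1)

    f' : ℕ → ℕ → Carrier
    f' m k = pow (u r) k * pow q (tri k) * qbin q (m ∸ 1) k

    rhsA : (ℕ → Carrier) → ℕ → Carrier
    rhsA A n = Σ[ 1 ⋯ r ] λ m →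
      (pow d (m ∸ 1) * esym u (m ∸ 1) (r ∸ 1) + pow d m * esym u m (r ∸ 1)
       + Σ[ 1 ⋯ r ] (λ i → Σ[ 0 ⋯ (i ∸ 1) ⊓ (m ∸ 1) ] λ k →
           c' k i * b' (m ∸ k) i * pow q (i ℕ.* (n ∸ m))))
      * sign (suc m) * prev A n m

    rhsA' : (ℕ → Carrier) → ℕ → Carrier
    rhsA' A n = Σ[ 1 ⋯ r ] λ m →
      (Σ[ 0 ⋯ r ∸ 1 ] (λ ν → Σ[ 0 ⋯ (m ∸ 1) ⊓ ν ] λ μ →
          f' m μ * e' m (ν ∸ μ) * pow q (ν ℕ.* (n ∸ m)))
       + u r * Σ[ 1 ⋯ r ] (λ ν → Σ[ 0 ⋯ (m ∸ 1) ⊓ (ν ∸ 1) ] λ μ →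
          f' m μ * e' m (ν ∸ μ ∸ 1) * pow q (ν ℕ.* (n ∸ m))))
      * sign (suc m) * prev A n m

module Submission where

-- Both recurrences have the shape (1 - q^n) A_n = Σ_m κ_m (q^(n-m)) (-1)^(m+1) A_(n-m), and 1 - q^n is a
-- unit, so by strong induction it suffices that the coefficients κ_m agree as polynomials in z = q^(n-m).
-- Write s = r - 1, t = u_r, E_j = e_j(u_1,…,u_s) and W_j = E_j + d E_(j+1). Since
-- e_j(u_1,…,u_r) = E_j + t E_(j-1), the coefficient of z^(a+1) in κ_(b+1) is on the left
--   d^b Σ_(k+j=b) t^k q^(k(k+1)/2) [a,k] [a+j+1,j] (W_(a+j+1) + t W_(a+j))
-- and on the right
--   d^b Σ_(k+j=b) t^k q^(k(k+1)/2) [b,k] ([a+j+1,b] W_(a+j+1) + t [a+j,b] W_(a+j)).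
-- Regrouping the left sum, the terms at (k+1, j) and (k, j+1) share W_(a+j+1) and combine by the identity
--   q^(k+1) [a,k+1] [a+j+1,j] + [a,k] [a+j+2,j+1] = [k+j+2,k+1] [a+j+1,k+j+1],
-- which follows from the factorial formula for Gaussian binomials (q-factorials are units as well).
-- The constant coefficients agree directly, and the top coefficient z^r on the right vanishes because
-- e_j(u_1,…,u_s) = 0 for j > s.

open import Defs
open import Level using (Level)
open import Algebra.Bundles using (CommutativeRing)
open import Algebra.Definitions using (LeftInvertible)
import Algebra.Properties.Ring as RingProperties
open import Data.Bool using (true; false)
open import Data.Nat using (ℕ; zero; suc; _∸_; _⊓_; _≤_; _<_; _≤ᵇ_; z≤n; s≤s)
  renaming (_+_ to _+ⁿ_; _*_ to _*ⁿ_)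
import Data.Nat.Properties as ℕ
open import Data.Nat.DivMod using (_/_; +-distrib-/-∣ʳ; m*n/n≡m)
open import Data.Nat.Divisibility using (divides-refl)
open import Data.Nat.Induction using (<-rec)
open import Data.Nat.Tactic.RingSolver using (solve-∀)
open import Data.Product using (∃; _,_)
open import Relation.Binary.Definitions using (tri<; tri≈; tri>)
open import Relation.Binary.PropositionalEquality as ≡ using (_≡_)

suc[m+n]∸m≡suc[n] : ∀ m n → suc (m +ⁿ n) ∸ m ≡ suc n
suc[m+n]∸m≡suc[n] m n = ≡.trans (≡.cong (_∸ m) (≡.sym (ℕ.+-suc m n))) (ℕ.m+n∸m≡n m (suc n))

[n∸m]+suc[m+j]≡suc[n+j] : ∀ {m n} j → m ≤ n → (n ∸ m) +ⁿ suc (m +ⁿ j) ≡ suc (n +ⁿ j)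
[n∸m]+suc[m+j]≡suc[n+j] {m} {n} j m≤n = ≡.trans (ℕ.+-suc (n ∸ m) (m +ⁿ j))
  (≡.cong suc (≡.trans (≡.sym (ℕ.+-assoc (n ∸ m) m j)) (≡.cong (_+ⁿ j) (ℕ.m∸n+n≡m m≤n))))

m⊓n<o≤n⇒m<o : ∀ {m n o} → m ⊓ n < o → o ≤ n → m < o
m⊓n<o≤n⇒m<o m⊓n<o o≤n = ℕ.≰⇒> (λ o≤m → ℕ.<⇒≱ m⊓n<o (ℕ.⊓-glb o≤m o≤n))

m⊓n<o≤m⇒n<o : ∀ {m n o} → m ⊓ n < o → o ≤ m → n < o
m⊓n<o≤m⇒n<o {m} {n} m⊓n<o = m⊓n<o≤n⇒m<o (≡.subst (_< _) (ℕ.⊓-comm m n) m⊓n<o)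

module _ {c ℓ : Level} (R : CommutativeRing c ℓ) where
  open CommutativeRing R
  open WithRing R
  open RingProperties ring using (-‿distribʳ-*)
  open import Relation.Binary.Reasoning.Setoid setoid
  open import Algebra.Solver.Ring.NaturalCoefficients.Default commutativeSemiring
    using (solve; _:*_; _:+_; _:=_)

  pow-+ : ∀ x m n → pow x (m +ⁿ n) ≈ pow x m * pow x n
  pow-+ x zero    n = sym (*-identityˡ _)
  pow-+ x (suc m) n = trans (*-congˡ (pow-+ x m n)) (sym (*-assoc _ _ _))

  x≈0⇒y*x≈0 : ∀ {x} y → x ≈ 0# → y * x ≈ 0#
  x≈0⇒y*x≈0 y x≈0 = trans (*-congˡ x≈0) (zeroʳ y)

  x≈0⇒x*y≈0 : ∀ {x} y → x ≈ 0# → x * y ≈ 0#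
  x≈0⇒x*y≈0 y x≈0 = trans (*-congʳ x≈0) (zeroˡ y)

  Unit : Carrier → Set _
  Unit = LeftInvertible _≈_ 1# _*_

  *-unit : ∀ {x y} → Unit x → Unit y → Unit (x * y)
  *-unit {x} {y} (x⁻¹ , x⁻¹x≈1) (y⁻¹ , y⁻¹y≈1) = x⁻¹ * y⁻¹ ,
    trans (solve 4 (λ a b x y → (a :* b) :* (x :* y) := ((a :* x) :* (b :* y))) refl x⁻¹ y⁻¹ x y)
          (trans (*-cong x⁻¹x≈1 y⁻¹y≈1) (*-identityʳ 1#))

  *-cancelˡ-unit : ∀ {u x y} → Unit u → u * x ≈ u * y → x ≈ y
  *-cancelˡ-unit {u} {x} {y} (u⁻¹ , u⁻¹u≈1) ux≈uy = begin
    x               ≈⟨ sym (*-identityˡ x) ⟩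
    1# * x          ≈⟨ *-congʳ (sym u⁻¹u≈1) ⟩
    u⁻¹ * u * x     ≈⟨ *-assoc u⁻¹ u x ⟩
    u⁻¹ * (u * x)   ≈⟨ *-congˡ ux≈uy ⟩
    u⁻¹ * (u * y)   ≈⟨ sym (*-assoc u⁻¹ u y) ⟩
    u⁻¹ * u * y     ≈⟨ *-congʳ u⁻¹u≈1 ⟩
    1# * y          ≈⟨ *-identityˡ y ⟩
    y               ∎

  recurrence-unique : (κ : ℕ → Carrier) → (∀ n → 1 ≤ n → Unit (κ n)) →
    (F G : (ℕ → Carrier) → ℕ → Carrier) (A A' : ℕ → Carrier) →
    (∀ n → (∀ k → k ≤ n → A k ≈ A' k) → F A (suc n) ≈ G A' (suc n)) →
    A 0 ≈ A' 0 →
    (∀ n → 1 ≤ n → κ n * A n ≈ F A n) →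
    (∀ n → 1 ≤ n → κ n * A' n ≈ G A' n) →
    ∀ n → A n ≈ A' n
  recurrence-unique κ units F G A A' F≈G A₀≈A'₀ recA recA' = <-rec _ step
    where
    step : ∀ n → (∀ {k} → k < n → A k ≈ A' k) → A n ≈ A' n
    step zero    _  = A₀≈A'₀
    step (suc n) ih = *-cancelˡ-unit (units (suc n) (s≤s z≤n))
      (trans (recA (suc n) (s≤s z≤n))
        (trans (F≈G n (λ k k≤n → ih (s≤s k≤n))) (sym (recA' (suc n) (s≤s z≤n)))))

  sumFrom-cong : ∀ s len {f g : ℕ → Carrier} → (∀ k → s ≤ k → k < s +ⁿ len → f k ≈ g k) →
                 sumFrom s len f ≈ sumFrom s len g
  sumFrom-cong s zero      f≈g = refl
  sumFrom-cong s (suc len) f≈g =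
    +-cong (f≈g s ℕ.≤-refl (ℕ.m<m+n s (s≤s z≤n)))
           (sumFrom-cong (suc s) len
              (λ k s<k k<s+1+len → f≈g k (ℕ.<⇒≤ s<k) (≡.subst (k <_) (≡.sym (ℕ.+-suc s len)) k<s+1+len)))

  sumFrom-+ : ∀ s len (f g : ℕ → Carrier) →
              sumFrom s len (λ k → f k + g k) ≈ sumFrom s len f + sumFrom s len g
  sumFrom-+ s zero      f g = sym (+-identityʳ 0#)
  sumFrom-+ s (suc len) f g =
    trans (+-congˡ (sumFrom-+ (suc s) len f g))
          (solve 4 (λ a b x y → (a :+ b) :+ (x :+ y) := ((a :+ x) :+ (b :+ y))) refl (f s) (g s) _ _)

  sumFrom-*ˡ : ∀ s len x (f : ℕ → Carrier) → sumFrom s len (λ k → x * f k) ≈ x * sumFrom s len f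
  sumFrom-*ˡ s zero      x f = sym (zeroʳ x)
  sumFrom-*ˡ s (suc len) x f = trans (+-congˡ (sumFrom-*ˡ (suc s) len x f)) (sym (distribˡ x _ _))

  sumFrom-*ʳ : ∀ s len x (f : ℕ → Carrier) → sumFrom s len (λ k → f k * x) ≈ sumFrom s len f * x
  sumFrom-*ʳ s zero      x f = sym (zeroˡ x)
  sumFrom-*ʳ s (suc len) x f = trans (+-congˡ (sumFrom-*ʳ (suc s) len x f)) (sym (distribʳ x _ _))

  sumFrom-snoc : ∀ s len (f : ℕ → Carrier) → sumFrom s (suc len) f ≈ sumFrom s len f + f (s +ⁿ len)
  sumFrom-snoc s zero      f = trans (+-identityʳ _)
    (trans (reflexive (≡.cong f (≡.sym (ℕ.+-identityʳ s)))) (sym (+-identityˡ _)))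
  sumFrom-snoc s (suc len) f =
    trans (+-congˡ (sumFrom-snoc (suc s) len f))
          (trans (sym (+-assoc _ _ _)) (+-congˡ (reflexive (≡.cong f (≡.sym (ℕ.+-suc s len))))))

  antidiag : ℕ → (ℕ → ℕ → Carrier) → Carrier
  antidiag zero    g = g 0 0
  antidiag (suc b) g = g 0 (suc b) + antidiag b (λ k j → g (suc k) j)

  antidiag-cong : ∀ b {f g : ℕ → ℕ → Carrier} → (∀ k j → k +ⁿ j ≡ b → f k j ≈ g k j) →
                  antidiag b f ≈ antidiag b g
  antidiag-cong zero    f≈g = f≈g 0 0 ≡.refl
  antidiag-cong (suc b) f≈g =
    +-cong (f≈g 0 (suc b) ≡.refl) (antidiag-cong b (λ k j k+j≡b → f≈g (suc k) j (≡.cong suc k+j≡b)))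

  antidiag-≈0 : ∀ b (g : ℕ → ℕ → Carrier) → (∀ k j → k +ⁿ j ≡ b → g k j ≈ 0#) → antidiag b g ≈ 0#
  antidiag-≈0 b g g≈0 = trans (antidiag-cong b g≈0) (zeros b)
    where
    zeros : ∀ b → antidiag b (λ _ _ → 0#) ≈ 0#
    zeros zero    = refl
    zeros (suc b) = trans (+-congˡ (zeros b)) (+-identityʳ 0#)

  antidiag-+ : ∀ b (f g : ℕ → ℕ → Carrier) →
               antidiag b (λ k j → f k j + g k j) ≈ antidiag b f + antidiag b g
  antidiag-+ zero    f g = refl
  antidiag-+ (suc b) f g =
    trans (+-congˡ (antidiag-+ b _ _))
          (solve 4 (λ a b x y → (a :+ b) :+ (x :+ y) := ((a :+ x) :+ (b :+ y))) refl _ _ _ _)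

  antidiag-*ˡ : ∀ b x (g : ℕ → ℕ → Carrier) → antidiag b (λ k j → x * g k j) ≈ x * antidiag b g
  antidiag-*ˡ zero    x g = refl
  antidiag-*ˡ (suc b) x g = trans (+-congˡ (antidiag-*ˡ b x _)) (sym (distribˡ x _ _))

  antidiag-snoc : ∀ b (g : ℕ → ℕ → Carrier) →
                  antidiag (suc b) g ≈ antidiag b (λ k j → g k (suc j)) + g (suc b) 0
  antidiag-snoc zero    g = refl
  antidiag-snoc (suc b) g = trans (+-congˡ (antidiag-snoc b (λ k j → g (suc k) j))) (sym (+-assoc _ _ _))

  antidiag-regroup : ∀ b (F G : ℕ → ℕ → Carrier) →
    antidiag (suc b) F + antidiag (suc b) G ≈
    (F 0 (suc b) + antidiag b (λ k j → F (suc k) j + G k (suc j))) + G (suc b) 0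
  antidiag-regroup b F G = begin
    antidiag (suc b) F + antidiag (suc b) G
      ≈⟨ +-congˡ (antidiag-snoc b G) ⟩
    (F 0 (suc b) + antidiag b (λ k j → F (suc k) j)) + (antidiag b (λ k j → G k (suc j)) + G (suc b) 0)
      ≈⟨ solve 4 (λ a x y z → (a :+ x) :+ (y :+ z) := ((a :+ (x :+ y)) :+ z)) refl _ _ _ _ ⟩
    (F 0 (suc b) + (antidiag b (λ k j → F (suc k) j) + antidiag b (λ k j → G k (suc j)))) + G (suc b) 0
      ≈⟨ +-congʳ (+-congˡ (sym (antidiag-+ b _ _))) ⟩
    (F 0 (suc b) + antidiag b (λ k j → F (suc k) j + G k (suc j))) + G (suc b) 0 ∎

  sumFrom≈antidiag : ∀ b len s (h : ℕ → Carrier) (g : ℕ → ℕ → Carrier) → len ≤ suc b →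
    (∀ k j → k +ⁿ j ≡ b → k < len → h (s +ⁿ k) ≈ g k j) →
    (∀ k j → k +ⁿ j ≡ b → len ≤ k → g k j ≈ 0#) →
    sumFrom s len h ≈ antidiag b g
  sumFrom≈antidiag zero zero s h g _ _ g≈0 = sym (g≈0 0 0 ≡.refl z≤n)
  sumFrom≈antidiag zero (suc zero) s h g _ h≈g _ =
    trans (+-identityʳ _) (trans (reflexive (≡.cong h (≡.sym (ℕ.+-identityʳ s)))) (h≈g 0 0 ≡.refl (s≤s z≤n)))
  sumFrom≈antidiag zero (suc (suc len)) s h g (s≤s ()) _ _
  sumFrom≈antidiag (suc b) zero s h g _ _ g≈0 =
    trans (sym (+-identityʳ 0#))
          (+-cong (sym (g≈0 0 (suc b) ≡.refl z≤n))
                  (sumFrom≈antidiag b 0 (suc s) h _ z≤n (λ _ _ _ ())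
                     (λ k j k+j≡b _ → g≈0 (suc k) j (≡.cong suc k+j≡b) z≤n)))
  sumFrom≈antidiag (suc b) (suc len) s h g (s≤s len≤b) h≈g g≈0 =
    +-cong (trans (reflexive (≡.cong h (≡.sym (ℕ.+-identityʳ s)))) (h≈g 0 (suc b) ≡.refl (s≤s z≤n)))
           (sumFrom≈antidiag b len (suc s) h _ len≤b
              (λ k j k+j≡b k<len → trans (reflexive (≡.cong h (≡.sym (ℕ.+-suc s k))))
                                         (h≈g (suc k) j (≡.cong suc k+j≡b) (s≤s k<len)))
              (λ k j k+j≡b len≤k → g≈0 (suc k) j (≡.cong suc k+j≡b) (s≤s len≤k)))

  s<n⇒esym≈0 : ∀ u n s → s < n → esym u n s ≈ 0#
  s<n⇒esym≈0 u (suc n) zero    _         = refl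
  s<n⇒esym≈0 u (suc n) (suc s) (s≤s s<n) =
    trans (+-cong (s<n⇒esym≈0 u (suc n) s (ℕ.m<n⇒m<1+n s<n)) (x≈0⇒y*x≈0 _ (s<n⇒esym≈0 u n s s<n)))
          (+-identityʳ 0#)

  tri-suc : ∀ k → tri (suc k) ≡ tri k +ⁿ suc k
  tri-suc k = ≡.trans (≡.cong (_/ 2) (product-split k))
                (≡.trans (+-distrib-/-∣ʳ (k *ⁿ suc k) (divides-refl (suc k)))
                         (≡.cong (tri k +ⁿ_) (m*n/n≡m (suc k) 2)))
    where
    product-split : ∀ k → suc k *ⁿ suc (suc k) ≡ k *ⁿ suc k +ⁿ suc k *ⁿ 2
    product-split = solve-∀

  pow-tri-suc : ∀ q k → pow q (tri (suc k)) ≈ pow q (tri k) * pow q (suc k)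
  pow-tri-suc q k = trans (reflexive (≡.cong (pow q) (tri-suc k))) (pow-+ q (tri k) (suc k))

  prev-cong : ∀ (A A' : ℕ → Carrier) n m → (∀ k → k ≤ n → A k ≈ A' k) →
              prev A (suc n) (suc m) ≈ prev A' (suc n) (suc m)
  prev-cong A A' n m A≈A' with suc m ≤ᵇ suc n
  ... | true  = A≈A' (n ∸ m) (ℕ.m∸n≤m n m)
  ... | false = refl

  module QNumbers (q : Carrier) where

    qbin[n,0]≈1 : ∀ n → qbin q n 0 ≈ 1#
    qbin[n,0]≈1 zero    = refl
    qbin[n,0]≈1 (suc n) = refl

    n<k⇒qbin[n,k]≈0 : ∀ n k → n < k → qbin q n k ≈ 0#
    n<k⇒qbin[n,k]≈0 zero    (suc k) _         = refl
    n<k⇒qbin[n,k]≈0 (suc n) (suc k) (s≤s n<k) =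
      trans (+-cong (n<k⇒qbin[n,k]≈0 n k n<k)
                    (x≈0⇒y*x≈0 _ (n<k⇒qbin[n,k]≈0 n (suc k) (ℕ.m<n⇒m<1+n n<k))))
            (+-identityʳ 0#)

    qbin[n,n]≈1 : ∀ n → qbin q n n ≈ 1#
    qbin[n,n]≈1 zero    = refl
    qbin[n,n]≈1 (suc n) =
      trans (+-cong (qbin[n,n]≈1 n) (x≈0⇒y*x≈0 _ (n<k⇒qbin[n,k]≈0 n (suc n) ℕ.≤-refl))) (+-identityʳ 1#)

    qint : ℕ → Carrier
    qint zero    = 0#
    qint (suc n) = 1# + q * qint n

    qfact : ℕ → Carrier
    qfact zero    = 1#
    qfact (suc n) = qfact n * qint (suc n)

    qint-+ : ∀ m n → qint (m +ⁿ n) ≈ qint m + pow q m * qint n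
    qint-+ zero    n = trans (sym (*-identityˡ _)) (sym (+-identityˡ _))
    qint-+ (suc m) n = trans (+-congˡ (*-congˡ (qint-+ m n)))
      (solve 5 (λ o x A p B → o :+ x :* (A :+ p :* B) := ((o :+ x :* A) :+ (x :* p) :* B))
             refl 1# q (qint m) (pow q m) (qint n))

    [1-q]*qint≈1-qⁿ : ∀ n → (1# - q) * qint n ≈ 1# - pow q n
    [1-q]*qint≈1-qⁿ zero    = trans (zeroʳ _) (sym (-‿inverseʳ 1#))
    [1-q]*qint≈1-qⁿ (suc n) = begin
      (1# - q) * (1# + q * qint n)
        ≈⟨ solve 4 (λ y o x i → y :* (o :+ x :* i) := (y :* o :+ x :* (y :* i))) refl (1# - q) 1# q (qint n) ⟩
      (1# - q) * 1# + q * ((1# - q) * qint n)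
        ≈⟨ +-cong (*-identityʳ _) (*-congˡ ([1-q]*qint≈1-qⁿ n)) ⟩
      (1# - q) + q * (1# - pow q n)
        ≈⟨ +-congˡ (trans (distribˡ q 1# _) (+-cong (*-identityʳ q) (sym (-‿distribʳ-* q (pow q n))))) ⟩
      (1# - q) + (q - q * pow q n)
        ≈⟨ solve 4 (λ o nq x nz → (o :+ nq) :+ (x :+ nz) := (o :+ ((nq :+ x) :+ nz))) refl 1# (- q) q _ ⟩
      1# + ((- q + q) - pow q (suc n))
        ≈⟨ +-congˡ (trans (+-congʳ (-‿inverseˡ q)) (+-identityˡ _)) ⟩
      1# - pow q (suc n) ∎

    qbin-qfact : ∀ k l → qbin q (k +ⁿ l) k * qfact k * qfact l ≈ qfact (k +ⁿ l)
    qbin-qfact zero    l = trans (*-congʳ (trans (*-identityʳ _) (qbin[n,0]≈1 l))) (*-identityˡ _)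
    qbin-qfact (suc k) zero rewrite ℕ.+-identityʳ k =
      trans (*-congʳ (trans (*-congʳ (qbin[n,n]≈1 (suc k))) (*-identityˡ _))) (*-identityʳ _)
    qbin-qfact (suc k) (suc l) = begin
      (B₀ + pk * B₁) * (qfact k * qint (suc k)) * (qfact l * qint (suc l))
        ≈⟨ solve 7 (λ B₀ pk B₁ fk ik fl il →
              (B₀ :+ pk :* B₁) :* (fk :* ik) :* (fl :* il) :=
              (B₀ :* fk :* (fl :* il) :* ik :+ pk :* (B₁ :* (fk :* ik) :* fl) :* il))
            refl B₀ pk B₁ (qfact k) (qint (suc k)) (qfact l) (qint (suc l)) ⟩
      B₀ * qfact k * (qfact l * qint (suc l)) * qint (suc k) + pk * (B₁ * (qfact k * qint (suc k)) * qfact l) * qint (suc l)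
        ≈⟨ +-cong (*-congʳ (qbin-qfact k (suc l))) (*-congʳ (*-congˡ shifted)) ⟩
      qfact n * qint (suc k) + pk * qfact n * qint (suc l)
        ≈⟨ solve 4 (λ f a p b → f :* a :+ p :* f :* b := f :* (a :+ p :* b))
             refl (qfact n) (qint (suc k)) pk (qint (suc l)) ⟩
      qfact n * (qint (suc k) + pk * qint (suc l))
        ≈⟨ *-congˡ (sym (qint-+ (suc k) (suc l))) ⟩
      qfact (suc n) ∎
      where
      n = k +ⁿ suc l
      B₀ = qbin q n k
      B₁ = qbin q n (suc k)
      pk = pow q (suc k)
      shifted : B₁ * (qfact k * qint (suc k)) * qfact l ≈ qfact n
      shifted = ≡.subst (λ z → qbin q z (suc k) * qfact (suc k) * qfact l ≈ qfact z)
                        (≡.sym (ℕ.+-suc k l)) (qbin-qfact (suc k) l)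

    qbin-qfact′ : ∀ k l n → k +ⁿ l ≡ n → qbin q n k * qfact k * qfact l ≈ qfact n
    qbin-qfact′ k l _ ≡.refl = qbin-qfact k l

    qint-exchange : ∀ k e j → let a = suc (k +ⁿ e) in
      pow q (suc k) * qint (suc e) * qint (suc j) + qint (suc (suc (a +ⁿ j))) * qint (suc k)
      ≈ qint (suc (suc (k +ⁿ j))) * qint (suc a)
    qint-exchange k e j = begin
      pk * iₑ * iⱼ + qint (suc (suc (a +ⁿ j))) * iₖ
        ≈⟨ +-congˡ (*-congʳ (trans split-aj (+-cong split-a (*-congʳ pow-a)))) ⟩
      pk * iₑ * iⱼ + ((iₖ + pk * iₑ) + (pk * pe) * iⱼ) * iₖ
        ≈⟨ solve 5 (λ pk iₑ iⱼ iₖ pe →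
             pk :* iₑ :* iⱼ :+ ((iₖ :+ pk :* iₑ) :+ (pk :* pe) :* iⱼ) :* iₖ :=
             (pk :* iⱼ :* (iₑ :+ pe :* iₖ) :+ iₖ :* (iₖ :+ pk :* iₑ))) refl pk iₑ iⱼ iₖ pe ⟩
      pk * iⱼ * (iₑ + pe * iₖ) + iₖ * (iₖ + pk * iₑ)
        ≈⟨ +-congʳ (*-congˡ swap) ⟩
      pk * iⱼ * (iₖ + pk * iₑ) + iₖ * (iₖ + pk * iₑ)
        ≈⟨ solve 4 (λ pk iₑ iⱼ iₖ →
             pk :* iⱼ :* (iₖ :+ pk :* iₑ) :+ iₖ :* (iₖ :+ pk :* iₑ) :=
             ((iₖ :+ pk :* iⱼ) :* (iₖ :+ pk :* iₑ))) refl pk iₑ iⱼ iₖ ⟩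
      (iₖ + pk * iⱼ) * (iₖ + pk * iₑ)
        ≈⟨ sym (*-cong split-kj split-a) ⟩
      qint (suc (suc (k +ⁿ j))) * qint (suc a) ∎
      where
      a = suc (k +ⁿ e)
      pk = pow q (suc k)
      pe = pow q (suc e)
      iₑ = qint (suc e)
      iⱼ = qint (suc j)
      iₖ = qint (suc k)
      a≡ : suc k +ⁿ suc e ≡ suc a
      a≡ = ≡.cong suc (ℕ.+-suc k e)
      split-a : qint (suc a) ≈ iₖ + pk * iₑ
      split-a = trans (reflexive (≡.cong qint (≡.sym a≡))) (qint-+ (suc k) (suc e))
      split-kj : qint (suc (suc (k +ⁿ j))) ≈ iₖ + pk * iⱼ
      split-kj = trans (reflexive (≡.cong qint (≡.cong suc (≡.sym (ℕ.+-suc k j))))) (qint-+ (suc k) (suc j))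
      split-aj : qint (suc (suc (a +ⁿ j))) ≈ qint (suc a) + pow q (suc a) * iⱼ
      split-aj = trans (reflexive (≡.cong qint (≡.cong suc (≡.sym (ℕ.+-suc a j))))) (qint-+ (suc a) (suc j))
      pow-a : pow q (suc a) ≈ pk * pe
      pow-a = trans (reflexive (≡.cong (pow q) (≡.sym a≡))) (pow-+ q (suc k) (suc e))
      swap : iₑ + pe * iₖ ≈ iₖ + pk * iₑ
      swap = trans (sym (qint-+ (suc e) (suc k)))
               (trans (reflexive (≡.cong qint (ℕ.+-comm (suc e) (suc k)))) (qint-+ (suc k) (suc e)))

  module QUnits (q : Carrier) (units : ∀ n → 1 ≤ n → Unit (1# - pow q n)) where
    open QNumbers q

    qint-unit : ∀ n → Unit (qint (suc n))
    qint-unit n with units (suc n) (s≤s z≤n)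
    ... | y , y[1-qⁿ]≈1 =
      y * (1# - q) , trans (*-assoc _ _ _) (trans (*-congˡ ([1-q]*qint≈1-qⁿ (suc n))) y[1-qⁿ]≈1)

    qfact-unit : ∀ n → Unit (qfact n)
    qfact-unit zero    = 1# , *-identityˡ 1#
    qfact-unit (suc n) = *-unit (qfact-unit n) (qint-unit n)

    qbin-sym : ∀ k l n → k +ⁿ l ≡ n → qbin q n k ≈ qbin q n l
    qbin-sym k l n k+l≡n = *-cancelˡ-unit (*-unit (qfact-unit k) (qfact-unit l)) (begin
      qfact k * qfact l * qbin q n k   ≈⟨ *-comm _ _ ⟩
      qbin q n k * (qfact k * qfact l) ≈⟨ sym (*-assoc _ _ _) ⟩
      qbin q n k * qfact k * qfact l   ≈⟨ qbin-qfact′ k l n k+l≡n ⟩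
      qfact n                          ≈⟨ sym (qbin-qfact′ l k n (≡.trans (ℕ.+-comm l k) k+l≡n)) ⟩
      qbin q n l * qfact l * qfact k   ≈⟨ *-assoc _ _ _ ⟩
      qbin q n l * (qfact l * qfact k) ≈⟨ *-comm _ _ ⟩
      qfact l * qfact k * qbin q n l   ≈⟨ *-congʳ (*-comm _ _) ⟩
      qfact k * qfact l * qbin q n l   ∎)

    QBinExchange : ℕ → ℕ → ℕ → Set _
    QBinExchange a j k =
      pow q (suc k) * qbin q a (suc k) * qbin q (suc (a +ⁿ j)) j + qbin q a k * qbin q (suc (suc (a +ⁿ j))) (suc j)
      ≈ qbin q (suc (suc (k +ⁿ j))) (suc k) * qbin q (suc (a +ⁿ j)) (suc (k +ⁿ j))

    -- Multiply by [k+1]! [e+1]! [j+1]! [a+1]! [k+j+1]!: every product of a Gaussian binomial with the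
    -- matching factorials collapses to a q-factorial, leaving the q-integer identity qint-exchange.
    qbin-exchange-above : ∀ k e j → QBinExchange (suc (k +ⁿ e)) j k
    qbin-exchange-above k e j = *-cancelˡ-unit U-unit (begin
      U * (pk * B₁ * B₂ + B₃ * B₄)
        ≈⟨ solve 15 (λ pk B₁ B₂ B₃ B₄ fk iₖ fe iₑ fj iⱼ fa iₐ fkj faj →
             (fk :* iₖ) :* (fe :* iₑ) :* (fj :* iⱼ) :* (fa :* iₐ) :* fkj :* (pk :* B₁ :* B₂ :+ B₃ :* B₄) :=
             (pk :* (B₁ :* (fk :* iₖ) :* fe) :* (B₂ :* fj :* (fa :* iₐ)) :* (iₑ :* iⱼ :* fkj)
              :+ (B₃ :* fk :* (fe :* iₑ)) :* (B₄ :* (fj :* iⱼ) :* (fa :* iₐ)) :* (iₖ :* fkj)))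
            refl pk B₁ B₂ B₃ B₄ (qfact k) iₖ (qfact e) iₑ (qfact j) iⱼ (qfact a) (qint (suc a)) Fkj Faj ⟩
      pk * (B₁ * qfact (suc k) * qfact e) * (B₂ * qfact j * qfact (suc a)) * (iₑ * iⱼ * Fkj)
        + (B₃ * qfact k * qfact (suc e)) * (B₄ * qfact (suc j) * qfact (suc a)) * (iₖ * Fkj)
        ≈⟨ +-cong (*-congʳ (*-cong (*-congˡ (qbin-qfact (suc k) e)) (qbin-qfact′ j (suc a) _ j+a+1≡)))
                  (*-congʳ (*-cong (qbin-qfact′ k (suc e) a (ℕ.+-suc k e))
                                   (qbin-qfact′ (suc j) (suc a) _ (≡.cong suc j+a+1≡)))) ⟩
      pk * qfact a * Faj * (iₑ * iⱼ * Fkj) + qfact a * (Faj * qint (suc (suc (a +ⁿ j)))) * (iₖ * Fkj)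
        ≈⟨ solve 8 (λ pk fa faj iₑ iⱼ fkj iaj iₖ →
             pk :* fa :* faj :* (iₑ :* iⱼ :* fkj) :+ fa :* (faj :* iaj) :* (iₖ :* fkj) :=
             (fa :* faj :* fkj :* (pk :* iₑ :* iⱼ :+ iaj :* iₖ)))
            refl pk (qfact a) Faj iₑ iⱼ Fkj (qint (suc (suc (a +ⁿ j)))) iₖ ⟩
      qfact a * Faj * Fkj * (pk * iₑ * iⱼ + qint (suc (suc (a +ⁿ j))) * iₖ)
        ≈⟨ *-congˡ (qint-exchange k e j) ⟩
      qfact a * Faj * Fkj * (qint (suc (suc (k +ⁿ j))) * qint (suc a))
        ≈⟨ solve 5 (λ fa faj fkj i₂ iₐ →
             fa :* faj :* fkj :* (i₂ :* iₐ) := ((fkj :* i₂) :* faj :* (fa :* iₐ)))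
            refl (qfact a) Faj Fkj (qint (suc (suc (k +ⁿ j)))) (qint (suc a)) ⟩
      qfact (suc (suc (k +ⁿ j))) * Faj * qfact (suc a)
        ≈⟨ sym (*-congʳ (*-cong (qbin-qfact′ (suc k) (suc j) _ (≡.cong suc (ℕ.+-suc k j)))
                                (qbin-qfact′ (suc (k +ⁿ j)) (suc e) _ k+j+e+1≡))) ⟩
      (B₅ * qfact (suc k) * qfact (suc j)) * (B₆ * Fkj * qfact (suc e)) * qfact (suc a)
        ≈⟨ solve 11 (λ B₅ B₆ fk iₖ fe iₑ fj iⱼ fa iₐ fkj →
             (B₅ :* (fk :* iₖ) :* (fj :* iⱼ)) :* (B₆ :* fkj :* (fe :* iₑ)) :* (fa :* iₐ) :=
             ((fk :* iₖ) :* (fe :* iₑ) :* (fj :* iⱼ) :* (fa :* iₐ) :* fkj :* (B₅ :* B₆)))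
            refl B₅ B₆ (qfact k) iₖ (qfact e) iₑ (qfact j) iⱼ (qfact a) (qint (suc a)) Fkj ⟩
      U * (B₅ * B₆) ∎)
      where
      a = suc (k +ⁿ e)
      pk = pow q (suc k)
      iₑ = qint (suc e)
      iⱼ = qint (suc j)
      iₖ = qint (suc k)
      B₁ = qbin q a (suc k)
      B₂ = qbin q (suc (a +ⁿ j)) j
      B₃ = qbin q a k
      B₄ = qbin q (suc (suc (a +ⁿ j))) (suc j)
      B₅ = qbin q (suc (suc (k +ⁿ j))) (suc k)
      B₆ = qbin q (suc (a +ⁿ j)) (suc (k +ⁿ j))
      Fkj = qfact (suc (k +ⁿ j))
      Faj = qfact (suc (a +ⁿ j))
      U = qfact (suc k) * qfact (suc e) * qfact (suc j) * qfact (suc a) * Fkj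
      U-unit : Unit U
      U-unit = *-unit (*-unit (*-unit (*-unit (qfact-unit (suc k)) (qfact-unit (suc e)))
                                      (qfact-unit (suc j))) (qfact-unit (suc a))) (qfact-unit (suc (k +ⁿ j)))
      j+a+1≡ : j +ⁿ suc a ≡ suc (a +ⁿ j)
      j+a+1≡ = ≡.trans (ℕ.+-suc j a) (≡.cong suc (ℕ.+-comm j a))
      k+j+e+1≡ : suc (k +ⁿ j) +ⁿ suc e ≡ suc (a +ⁿ j)
      k+j+e+1≡ = ≡.cong suc (≡.trans (ℕ.+-suc (k +ⁿ j) e) (≡.cong suc (xy∙z≈xz∙y k j e)))
        where open import Algebra.Properties.CommutativeSemigroup ℕ.+-commutativeSemigroup using (xy∙z≈xz∙y)

    qbin-exchange : ∀ a j k → QBinExchange a j k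
    qbin-exchange a j k with ℕ.<-cmp a k
    ... | tri< a<k _ _ = begin
      pow q (suc k) * qbin q a (suc k) * qbin q (suc (a +ⁿ j)) j + qbin q a k * qbin q (suc (suc (a +ⁿ j))) (suc j)
        ≈⟨ +-cong (x≈0⇒x*y≈0 _ (x≈0⇒y*x≈0 _ (n<k⇒qbin[n,k]≈0 a (suc k) (ℕ.m<n⇒m<1+n a<k))))
                  (x≈0⇒x*y≈0 _ (n<k⇒qbin[n,k]≈0 a k a<k)) ⟩
      0# + 0#
        ≈⟨ +-identityʳ 0# ⟩
      0#
        ≈⟨ sym (x≈0⇒y*x≈0 _
             (n<k⇒qbin[n,k]≈0 (suc (a +ⁿ j)) (suc (k +ⁿ j)) (s≤s (ℕ.+-monoˡ-< j a<k)))) ⟩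
      qbin q (suc (suc (k +ⁿ j))) (suc k) * qbin q (suc (a +ⁿ j)) (suc (k +ⁿ j)) ∎
    ... | tri≈ _ ≡.refl _ = begin
      pow q (suc a) * qbin q a (suc a) * qbin q (suc (a +ⁿ j)) j + qbin q a a * qbin q (suc (suc (a +ⁿ j))) (suc j)
        ≈⟨ +-cong (x≈0⇒x*y≈0 _ (x≈0⇒y*x≈0 _ (n<k⇒qbin[n,k]≈0 a (suc a) ℕ.≤-refl)))
                  (trans (*-congʳ (qbin[n,n]≈1 a)) (*-identityˡ _)) ⟩
      0# + qbin q (suc (suc (a +ⁿ j))) (suc j)
        ≈⟨ +-identityˡ _ ⟩
      qbin q (suc (suc (a +ⁿ j))) (suc j)
        ≈⟨ qbin-sym (suc j) (suc a) _ (≡.cong suc (≡.trans (ℕ.+-suc j a) (≡.cong suc (ℕ.+-comm j a)))) ⟩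
      qbin q (suc (suc (a +ⁿ j))) (suc a)
        ≈⟨ sym (trans (*-congˡ (qbin[n,n]≈1 (suc (a +ⁿ j)))) (*-identityʳ _)) ⟩
      qbin q (suc (suc (a +ⁿ j))) (suc a) * qbin q (suc (a +ⁿ j)) (suc (a +ⁿ j)) ∎
    ... | tri> _ _ k<a = ≡.subst (λ a → QBinExchange a j k) (ℕ.m+[n∸m]≡n k<a) (qbin-exchange-above k (a ∸ suc k) j)

  module Coefficients (s : ℕ) (u : ℕ → Carrier) (d q : Carrier)
                      (units : ∀ n → 1 ≤ n → Unit (1# - pow q n)) where
    open Params (suc s) u d q
    open QNumbers q
    open QUnits q units

    t : Carrier
    t = u (suc s)

    E W : ℕ → Carrier
    E j = esym u j s
    W j = E j + d * E (suc j)

    τ : ℕ → Carrier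
    τ k = pow t k * pow q (tri k)

    -- The summands at z^(a+1) of the coefficient of A_(n-b-1), indexed by k + j = b, with d^b taken out:
    -- cbTerm for the left recurrence, feTerm₀ + t feTerm₁ for the right one.
    cbWeight : ℕ → ℕ → ℕ → Carrier
    cbWeight a k j = τ k * qbin q a k * qbin q (suc (a +ⁿ j)) j

    cbTerm : ℕ → ℕ → ℕ → Carrier
    cbTerm a k j = cbWeight a k j * (W (suc (a +ⁿ j)) + t * W (a +ⁿ j))

    feTerm₀ feTerm₁ : ℕ → ℕ → ℕ → ℕ → Carrier
    feTerm₀ a b k j = τ k * qbin q b k * qbin q (suc (a +ⁿ j)) b * W (suc (a +ⁿ j))
    feTerm₁ a b k j = τ k * qbin q b k * qbin q (a +ⁿ j) b * W (a +ⁿ j)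

    τ-suc : ∀ k → τ (suc k) ≈ t * (pow q (suc k) * τ k)
    τ-suc k = trans (*-congˡ (pow-tri-suc q k))
      (solve 4 (λ t tᵏ T p → (t :* tᵏ) :* (T :* p) := t :* (p :* (tᵏ :* T)))
             refl t (pow t k) (pow q (tri k)) (pow q (suc k)))

    s<j⇒W≈0 : ∀ j → s < j → W j ≈ 0#
    s<j⇒W≈0 j s<j =
      trans (+-cong (s<n⇒esym≈0 u j s s<j) (x≈0⇒y*x≈0 d (s<n⇒esym≈0 u (suc j) s (ℕ.m<n⇒m<1+n s<j))))
            (+-identityʳ 0#)

    cb≈cbTerm : ∀ a k j → c' k (suc a) * b' (suc (k +ⁿ j) ∸ k) (suc a) ≈ pow d (k +ⁿ j) * cbTerm a k j
    cb≈cbTerm a k j rewrite suc[m+n]∸m≡suc[n] k j | ℕ.+-suc a j =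
      trans (solve 11 (λ dᵏ dʲ d tᵏ T Bₐ Bⱼ E₀ E₁ E₂ t →
               (dᵏ :* tᵏ :* T :* Bₐ) :* ((dʲ :* (E₁ :+ t :* E₀) :+ (d :* dʲ) :* (E₂ :+ t :* E₁)) :* Bⱼ) :=
               (dᵏ :* dʲ) :* ((tᵏ :* T :* Bₐ :* Bⱼ) :* ((E₁ :+ d :* E₂) :+ t :* (E₀ :+ d :* E₁))))
             refl (pow d k) (pow d j) d (pow t k) (pow q (tri k)) (qbin q a k) (qbin q (suc (a +ⁿ j)) j)
                  (E (a +ⁿ j)) (E (suc (a +ⁿ j))) (E (suc (suc (a +ⁿ j)))) t)
            (*-congʳ (sym (pow-+ d k j)))

    collect-dᵇ : ∀ dᵇ X B E₁ E₂ → X * ((dᵇ * E₁ + d * dᵇ * E₂) * B) ≈ dᵇ * (X * B * (E₁ + d * E₂))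
    collect-dᵇ dᵇ X B E₁ E₂ =
      solve 6 (λ d dᵇ X B E₁ E₂ → X :* ((dᵇ :* E₁ :+ d :* dᵇ :* E₂) :* B) := dᵇ :* (X :* B :* (E₁ :+ d :* E₂)))
            refl d dᵇ X B E₁ E₂

    fe≈feTerm₀ : ∀ a k j → k ≤ suc a →
      f' (suc (k +ⁿ j)) k * e' (suc (k +ⁿ j)) (suc a ∸ k) ≈ pow d (k +ⁿ j) * feTerm₀ a (k +ⁿ j) k j
    fe≈feTerm₀ a k j k≤1+a rewrite [n∸m]+suc[m+j]≡suc[n+j] j k≤1+a =
      collect-dᵇ (pow d (k +ⁿ j)) (τ k * qbin q (k +ⁿ j) k) (qbin q (suc (a +ⁿ j)) (k +ⁿ j))
                 (E (suc (a +ⁿ j))) (E (suc (suc (a +ⁿ j))))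

    fe≈feTerm₁ : ∀ a k j → k ≤ a →
      f' (suc (k +ⁿ j)) k * e' (suc (k +ⁿ j)) (suc a ∸ k ∸ 1) ≈ pow d (k +ⁿ j) * feTerm₁ a (k +ⁿ j) k j
    fe≈feTerm₁ a k j k≤a rewrite ℕ.+-∸-assoc 1 k≤a | [n∸m]+suc[m+j]≡suc[n+j] j k≤a =
      collect-dᵇ (pow d (k +ⁿ j)) (τ k * qbin q (k +ⁿ j) k) (qbin q (a +ⁿ j) (k +ⁿ j)) (E (a +ⁿ j)) (E (suc (a +ⁿ j)))

    cbSum≈antidiag : ∀ a b →
      Σ[ 0 ⋯ a ⊓ b ] (λ k → c' k (suc a) * b' (suc b ∸ k) (suc a)) ≈ pow d b * antidiag b (cbTerm a)
    cbSum≈antidiag a b = trans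
      (sumFrom≈antidiag b (suc (a ⊓ b)) 0 _ _ (s≤s (ℕ.m⊓n≤n a b))
        (λ { k j ≡.refl _ → cb≈cbTerm a k j })
        (λ { k j ≡.refl a⊓b<k → x≈0⇒y*x≈0 _ (x≈0⇒x*y≈0 _ (x≈0⇒x*y≈0 _ (x≈0⇒y*x≈0 _
             (n<k⇒qbin[n,k]≈0 a k (m⊓n<o≤n⇒m<o a⊓b<k (ℕ.m≤m+n k j)))))) }))
      (antidiag-*ˡ b (pow d b) (cbTerm a))

    feSum₀≈antidiag : ∀ a b →
      Σ[ 0 ⋯ b ⊓ suc a ] (λ μ → f' (suc b) μ * e' (suc b) (suc a ∸ μ)) ≈ pow d b * antidiag b (feTerm₀ a b)
    feSum₀≈antidiag a b = trans
      (sumFrom≈antidiag b (suc (b ⊓ suc a)) 0 _ _ (s≤s (ℕ.m⊓n≤m b (suc a)))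
        (λ { k j ≡.refl (s≤s k≤b⊓1+a) → fe≈feTerm₀ a k j (ℕ.m≤n⊓o⇒m≤o (k +ⁿ j) (suc a) k≤b⊓1+a) })
        (λ { k j ≡.refl b⊓1+a<k → x≈0⇒y*x≈0 _ (x≈0⇒x*y≈0 _ (x≈0⇒y*x≈0 _
             (n<k⇒qbin[n,k]≈0 (suc (a +ⁿ j)) (k +ⁿ j) (ℕ.+-monoˡ-< j (m⊓n<o≤m⇒n<o b⊓1+a<k (ℕ.m≤m+n k j)))))) }))
      (antidiag-*ˡ b (pow d b) (feTerm₀ a b))

    feSum₁≈antidiag : ∀ a b →
      Σ[ 0 ⋯ b ⊓ a ] (λ μ → f' (suc b) μ * e' (suc b) (suc a ∸ μ ∸ 1)) ≈ pow d b * antidiag b (feTerm₁ a b)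
    feSum₁≈antidiag a b = trans
      (sumFrom≈antidiag b (suc (b ⊓ a)) 0 _ _ (s≤s (ℕ.m⊓n≤m b a))
        (λ { k j ≡.refl (s≤s k≤b⊓a) → fe≈feTerm₁ a k j (ℕ.m≤n⊓o⇒m≤o (k +ⁿ j) a k≤b⊓a) })
        (λ { k j ≡.refl b⊓a<k → x≈0⇒y*x≈0 _ (x≈0⇒x*y≈0 _ (x≈0⇒y*x≈0 _
             (n<k⇒qbin[n,k]≈0 (a +ⁿ j) (k +ⁿ j) (ℕ.+-monoˡ-< j (m⊓n<o≤m⇒n<o b⊓a<k (ℕ.m≤m+n k j)))))) }))
      (antidiag-*ˡ b (pow d b) (feTerm₁ a b))

    cbTerm-exchange : ∀ a k j →
      cbWeight a (suc k) j * W (suc (a +ⁿ j)) + cbWeight a k (suc j) * (t * W (a +ⁿ suc j))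
      ≈ feTerm₀ a (suc (k +ⁿ j)) (suc k) j + t * feTerm₁ a (suc (k +ⁿ j)) k (suc j)
    cbTerm-exchange a k j rewrite ℕ.+-suc a j = begin
      τ (suc k) * A₁ * Bⱼ * W₁ + τ k * A₀ * B₊ * (t * W₁)
        ≈⟨ +-congʳ (*-congʳ (*-congʳ (*-congʳ (τ-suc k)))) ⟩
      t * (p * τ k) * A₁ * Bⱼ * W₁ + τ k * A₀ * B₊ * (t * W₁)
        ≈⟨ solve 8 (λ t p τ A₁ Bⱼ W₁ A₀ B₊ →
             t :* (p :* τ) :* A₁ :* Bⱼ :* W₁ :+ τ :* A₀ :* B₊ :* (t :* W₁) :=
             t :* τ :* W₁ :* (p :* A₁ :* Bⱼ :+ A₀ :* B₊))
           refl t p (τ k) A₁ Bⱼ W₁ A₀ B₊ ⟩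
      t * τ k * W₁ * (p * A₁ * Bⱼ + A₀ * B₊)
        ≈⟨ *-congˡ (qbin-exchange a j k) ⟩
      t * τ k * W₁ * ((C₀ + p * C₁) * Bₜ)
        ≈⟨ solve 7 (λ t p τ W₁ C₀ C₁ Bₜ →
             t :* τ :* W₁ :* ((C₀ :+ p :* C₁) :* Bₜ) :=
             t :* (p :* τ) :* C₁ :* Bₜ :* W₁ :+ t :* (τ :* C₀ :* Bₜ :* W₁))
           refl t p (τ k) W₁ C₀ C₁ Bₜ ⟩
      t * (p * τ k) * C₁ * Bₜ * W₁ + t * (τ k * C₀ * Bₜ * W₁)
        ≈⟨ +-congʳ (*-congʳ (*-congʳ (*-congʳ (sym (τ-suc k))))) ⟩
      τ (suc k) * C₁ * Bₜ * W₁ + t * (τ k * C₀ * Bₜ * W₁) ∎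
      where
      p = pow q (suc k)
      A₀ = qbin q a k
      A₁ = qbin q a (suc k)
      Bⱼ = qbin q (suc (a +ⁿ j)) j
      B₊ = qbin q (suc (suc (a +ⁿ j))) (suc j)
      Bₜ = qbin q (suc (a +ⁿ j)) (suc (k +ⁿ j))
      C₀ = qbin q (suc (k +ⁿ j)) k
      C₁ = qbin q (suc (k +ⁿ j)) (suc k)
      W₁ = W (suc (a +ⁿ j))

    cbTerm-antidiag : ∀ a b → antidiag b (cbTerm a) ≈ antidiag b (feTerm₀ a b) + t * antidiag b (feTerm₁ a b)
    cbTerm-antidiag a zero = begin
      τ 0 * qbin q a 0 * 1# * (W₁ + t * W₀)
        ≈⟨ *-congʳ (*-congʳ (*-congˡ (qbin[n,0]≈1 a))) ⟩
      τ 0 * 1# * 1# * (W₁ + t * W₀)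
        ≈⟨ solve 5 (λ τ o W₁ t W₀ →
             τ :* o :* o :* (W₁ :+ t :* W₀) := τ :* o :* o :* W₁ :+ t :* (τ :* o :* o :* W₀))
             refl (τ 0) 1# W₁ t W₀ ⟩
      τ 0 * 1# * 1# * W₁ + t * (τ 0 * 1# * 1# * W₀)
        ≈⟨ +-congˡ (*-congˡ (*-congʳ (*-congˡ (sym (qbin[n,0]≈1 (a +ⁿ 0)))))) ⟩
      feTerm₀ a 0 0 0 + t * feTerm₁ a 0 0 0 ∎
      where
      W₀ = W (a +ⁿ 0)
      W₁ = W (suc (a +ⁿ 0))
    cbTerm-antidiag a (suc b) = begin
      antidiag (suc b) (cbTerm a)
        ≈⟨ antidiag-cong (suc b) (λ k j _ → distribˡ (cbWeight a k j) (W (suc (a +ⁿ j))) (t * W (a +ⁿ j))) ⟩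
      antidiag (suc b) (λ k j → F k j + G k j)
        ≈⟨ antidiag-+ (suc b) F G ⟩
      antidiag (suc b) F + antidiag (suc b) G
        ≈⟨ antidiag-regroup b F G ⟩
      (F 0 (suc b) + antidiag b (λ k j → F (suc k) j + G k (suc j))) + G (suc b) 0
        ≈⟨ +-cong (+-cong first (antidiag-cong b (λ { k j ≡.refl → cbTerm-exchange a k j }))) last ⟩
      (feTerm₀ a (suc b) 0 (suc b) + antidiag b (λ k j → feTerm₀ a (suc b) (suc k) j + T₁ k (suc j))) + T₁ (suc b) 0
        ≈⟨ sym (antidiag-regroup b (feTerm₀ a (suc b)) T₁) ⟩
      antidiag (suc b) (feTerm₀ a (suc b)) + antidiag (suc b) T₁
        ≈⟨ +-congˡ (antidiag-*ˡ (suc b) t (feTerm₁ a (suc b))) ⟩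
      antidiag (suc b) (feTerm₀ a (suc b)) + t * antidiag (suc b) (feTerm₁ a (suc b)) ∎
      where
      F G T₁ : ℕ → ℕ → Carrier
      F k j = cbWeight a k j * W (suc (a +ⁿ j))
      G k j = cbWeight a k j * (t * W (a +ⁿ j))
      T₁ k j = t * feTerm₁ a (suc b) k j
      first : F 0 (suc b) ≈ feTerm₀ a (suc b) 0 (suc b)
      first = *-congʳ (*-congʳ (*-congˡ (qbin[n,0]≈1 a)))
      last : G (suc b) 0 ≈ T₁ (suc b) 0
      last = trans
        (solve 5 (λ τ A o t W → τ :* A :* o :* (t :* W) := t :* (τ :* o :* A :* W))
               refl (τ (suc b)) (qbin q a (suc b)) 1# t (W (a +ⁿ 0)))
        (*-congˡ (*-congʳ (*-cong (*-congˡ (sym (qbin[n,n]≈1 (suc b))))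
                                  (reflexive (≡.cong (λ n → qbin q n (suc b)) (≡.sym (ℕ.+-identityʳ a)))))))

    cbSum≈feSums : ∀ a b x →
      Σ[ 0 ⋯ a ⊓ b ] (λ k → c' k (suc a) * b' (suc b ∸ k) (suc a) * x)
      ≈ Σ[ 0 ⋯ b ⊓ suc a ] (λ μ → f' (suc b) μ * e' (suc b) (suc a ∸ μ) * x)
        + t * Σ[ 0 ⋯ b ⊓ a ] (λ μ → f' (suc b) μ * e' (suc b) (suc a ∸ μ ∸ 1) * x)
    cbSum≈feSums a b x = begin
      Σ[ 0 ⋯ a ⊓ b ] (λ k → c' k (suc a) * b' (suc b ∸ k) (suc a) * x)
        ≈⟨ sumFrom-*ʳ 0 (suc (a ⊓ b)) x _ ⟩
      Σ[ 0 ⋯ a ⊓ b ] (λ k → c' k (suc a) * b' (suc b ∸ k) (suc a)) * x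
        ≈⟨ *-congʳ (trans (cbSum≈antidiag a b) (*-congˡ (cbTerm-antidiag a b))) ⟩
      pow d b * (antidiag b (feTerm₀ a b) + t * antidiag b (feTerm₁ a b)) * x
        ≈⟨ solve 5 (λ D T₀ t T₁ x → D :* (T₀ :+ t :* T₁) :* x := D :* T₀ :* x :+ t :* (D :* T₁ :* x))
             refl (pow d b) (antidiag b (feTerm₀ a b)) t (antidiag b (feTerm₁ a b)) x ⟩
      pow d b * antidiag b (feTerm₀ a b) * x + t * (pow d b * antidiag b (feTerm₁ a b) * x)
        ≈⟨ sym (+-cong (trans (sumFrom-*ʳ 0 (suc (b ⊓ suc a)) x _) (*-congʳ (feSum₀≈antidiag a b)))
                       (*-congˡ (trans (sumFrom-*ʳ 0 (suc (b ⊓ a)) x _) (*-congʳ (feSum₁≈antidiag a b))))) ⟩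
      Σ[ 0 ⋯ b ⊓ suc a ] (λ μ → f' (suc b) μ * e' (suc b) (suc a ∸ μ) * x)
        + t * Σ[ 0 ⋯ b ⊓ a ] (λ μ → f' (suc b) μ * e' (suc b) (suc a ∸ μ ∸ 1) * x) ∎

    feSum-top≈0 : ∀ b x → Σ[ 0 ⋯ b ⊓ suc s ] (λ μ → f' (suc b) μ * e' (suc b) (suc s ∸ μ) * x) ≈ 0#
    feSum-top≈0 b x = trans (sumFrom-*ʳ 0 (suc (b ⊓ suc s)) x _)
      (x≈0⇒x*y≈0 x (trans (feSum₀≈antidiag s b) (x≈0⇒y*x≈0 _ (antidiag-≈0 b _
        (λ k j _ → x≈0⇒y*x≈0 _ (s<j⇒W≈0 (suc (s +ⁿ j)) (s≤s (ℕ.m≤m+n s j))))))))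

    feSum-bottom : ∀ b z → Σ[ 0 ⋯ b ⊓ 0 ] (λ μ → f' (suc b) μ * e' (suc b) (0 ∸ μ) * pow q (0 *ⁿ z))
                           ≈ pow d b * esym u b s + pow d (suc b) * esym u (suc b) s
    feSum-bottom b z rewrite ℕ.⊓-zeroʳ b =
      trans (+-identityʳ _) (trans (*-identityʳ _)
        (trans (*-cong (trans (*-congˡ (qbin[n,0]≈1 b)) (trans (*-identityʳ _) (*-identityʳ 1#)))
                       (trans (*-congˡ (qbin[n,n]≈1 b)) (*-identityʳ _)))
               (*-identityˡ _)))

    coefficients-agree : ∀ b z →
      pow d b * esym u b s + pow d (suc b) * esym u (suc b) s
        + Σ[ 1 ⋯ suc s ] (λ i → Σ[ 0 ⋯ (i ∸ 1) ⊓ b ] λ k → c' k i * b' (suc b ∸ k) i * pow q (i *ⁿ z))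
      ≈ Σ[ 0 ⋯ s ] (λ ν → Σ[ 0 ⋯ b ⊓ ν ] λ μ → f' (suc b) μ * e' (suc b) (ν ∸ μ) * pow q (ν *ⁿ z))
        + t * Σ[ 1 ⋯ suc s ] (λ ν → Σ[ 0 ⋯ b ⊓ (ν ∸ 1) ] λ μ →
            f' (suc b) μ * e' (suc b) (ν ∸ μ ∸ 1) * pow q (ν *ⁿ z))
    coefficients-agree b z = begin
      constant + sumFrom 1 (suc s) cbSum
        ≈⟨ +-congˡ (sumFrom-cong 1 (suc s) (λ { (suc a) _ _ → cbSum≈feSums a b _ })) ⟩
      constant + sumFrom 1 (suc s) (λ ν → feSum₀ ν + t * feSum₁ ν)
        ≈⟨ +-congˡ (trans (sumFrom-+ 1 (suc s) feSum₀ (λ ν → t * feSum₁ ν))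
                          (+-congˡ (sumFrom-*ˡ 1 (suc s) t feSum₁))) ⟩
      constant + (sumFrom 1 (suc s) feSum₀ + t * sumFrom 1 (suc s) feSum₁)
        ≈⟨ +-congˡ (+-congʳ (trans (sumFrom-snoc 1 s feSum₀)
                                   (trans (+-congˡ (feSum-top≈0 b _)) (+-identityʳ _)))) ⟩
      constant + (sumFrom 1 s feSum₀ + t * sumFrom 1 (suc s) feSum₁)
        ≈⟨ sym (+-assoc _ _ _) ⟩
      (constant + sumFrom 1 s feSum₀) + t * sumFrom 1 (suc s) feSum₁
        ≈⟨ +-congʳ (+-congʳ (sym (feSum-bottom b z))) ⟩
      (feSum₀ 0 + sumFrom 1 s feSum₀) + t * sumFrom 1 (suc s) feSum₁ ∎
      where
      constant = pow d b * esym u b s + pow d (suc b) * esym u (suc b) s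
      cbSum feSum₀ feSum₁ : ℕ → Carrier
      cbSum i = Σ[ 0 ⋯ (i ∸ 1) ⊓ b ] λ k → c' k i * b' (suc b ∸ k) i * pow q (i *ⁿ z)
      feSum₀ ν = Σ[ 0 ⋯ b ⊓ ν ] λ μ → f' (suc b) μ * e' (suc b) (ν ∸ μ) * pow q (ν *ⁿ z)
      feSum₁ ν = Σ[ 0 ⋯ b ⊓ (ν ∸ 1) ] λ μ → f' (suc b) μ * e' (suc b) (ν ∸ μ ∸ 1) * pow q (ν *ⁿ z)

    rhsA≈rhsA' : ∀ (A A' : ℕ → Carrier) n → (∀ k → k ≤ n → A k ≈ A' k) →
                 rhsA A (suc n) ≈ rhsA' A' (suc n)
    rhsA≈rhsA' A A' n A≈A' = sumFrom-cong 1 (suc s)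
      (λ { (suc b) _ _ → *-cong (*-congʳ (coefficients-agree b (suc n ∸ suc b))) (prev-cong A A' n b A≈A') })

lemma3p11 : ∀ {c ℓ : Level} (R : CommutativeRing c ℓ) →
    let open CommutativeRing R
        open WithRing R
    in (r : ℕ) → 2 ≤ r →
       (u : ℕ → Carrier) (d q : Carrier) →
       (∀ n → 1 ≤ n → ∃ λ y → y * (1# - pow q n) ≈ 1#) →
       (A A' : ℕ → Carrier) →
       A 0 ≈ 1# →
       (∀ n → 1 ≤ n → (1# - pow q n) * A n ≈ Params.rhsA r u d q A n) →
       A' 0 ≈ 1# →
       (∀ n → 1 ≤ n → (1# - pow q n) * A' n ≈ Params.rhsA' r u d q A' n) →
       ∀ n → A n ≈ A' n
lemma3p11 R (suc s) _ u d q units A A' A₀≈1 recA A'₀≈1 recA' =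
  recurrence-unique R (λ n → 1# - pow q n) units rhsA rhsA' A A' (Coefficients.rhsA≈rhsA' R s u d q units A A')
    (trans A₀≈1 (sym A'₀≈1)) recA recA'
  where
  open CommutativeRing R using (1#; _-_; trans; sym)
  open WithRing R using (pow; module Params)
  open Params (suc s) u d q using (rhsA; rhsA')
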